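{- Let $q,a_1$ be integers such that $q\geq 3$ and $|a_1|\leq 2\sqrt{q}$. If $-a_3=\lfloor 2\sqrt{q}^{\,3}\rfloor$, then $a_1=-\lfloor 2\sqrt{q}\rfloor$ or $a_1=[\sqrt{q}]$.
   Context: $\sqrt{q}>0$, $a_3=a_1^3-3qa_1$ (equivalently $a_3=\alpha^3+\bar\alpha^3$ for $\alpha$ a root of $X^2-a_1X+q$), and $[\sqrt{q}]$ denotes the integer nearest to $\sqrt{q}$. -}

module Defs where

open import Data.Integer using (ℤ; +_; _+_; _-_; _*_; -_; _≤_; _<_)
open import Data.Product using (_×_)

-- a₃ = a₁³ − 3 q a₁  (= α³ + ᾱ³ for α a root of X² − a₁X + q)
a₃ : ℤ → ℤ → ℤ
a₃ q a₁ = a₁ * a₁ * a₁ - + 3 * q * a₁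

-- |a₁| ≤ 2√q, stated without reals: a₁² ≤ 4q (equivalent since 2√q ≥ 0)
AbsLe2Sqrt : ℤ → ℤ → Set
AbsLe2Sqrt q a₁ = a₁ * a₁ ≤ + 4 * q

IsFloorSqrt : ℤ → ℤ → Set
IsFloorSqrt x n = (+ 0 ≤ n) × (n * n ≤ x) × (x < (n + + 1) * (n + + 1))

-- ⌊2√q⌋ = ⌊√(4q)⌋ ;  ⌊2√q³⌋ = ⌊√(4q³)⌋
IsFloor2Sqrt : ℤ → ℤ → Set
IsFloor2Sqrt q n = IsFloorSqrt (+ 4 * q) n

IsFloor2SqrtCube : ℤ → ℤ → Set
IsFloor2SqrtCube q n = IsFloorSqrt (+ 4 * q * q * q) n

-- r = [√q], the integer nearest to √q (q ≥ 1): |r − √q| < 1/2, i.e.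
-- 2r − 1 < 2√q < 2r + 1; for r ≥ 0 this is (2r−1)² < 4q < (2r+1)²
-- (the nearest integer to a positive real is ≥ 0).
IsNearestSqrt : ℤ → ℤ → Set
IsNearestSqrt q r =
  (+ 0 ≤ r) × ((+ 2 * r - + 1) * (+ 2 * r - + 1) < + 4 * q)
            × (+ 4 * q < (+ 2 * r + + 1) * (+ 2 * r + + 1))

-- With α a root of X² − a₁X + q we have a₃ = α³ + ᾱ³, and comparing the discriminants of
-- X² − a₁X + q and X² − a₃X + q³ gives 4q³ − a₃² = (4q − a₁²)(q − a₁²)². As −a₃ = ⌊√(4q³)⌋,
-- this is at most 2(−a₃) = 2a₁(3q − a₁²). For a₁ < 0 that forces 4q − a₁² ≤ 2|a₁|, i.e.
-- |a₁| = ⌊2√q⌋; a₁ = 0 is impossible; for a₁ > 0 it forces −a₁ < q − a₁² ≤ a₁, i.e. a₁ = [√q].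
module Submission where

open import Defs
open import Data.Integer using (ℤ; +_; -_; _≤_)
open import Data.Sum using (_⊎_)
open import Relation.Binary.PropositionalEquality using (_≡_)

open import Data.Integer using (-[1+_]; _+_; _-_; _*_; _<_; _≮_; +≤+; +<+; -≤+)
open import Data.Integer.Base using (nonNegative; positive)
open import Data.Integer.Properties
open import Data.Integer.Tactic.RingSolver using (solve-∀; solve)
open import Data.List using (_∷_; [])
open import Data.Nat as ℕ using (z≤n; s≤s)
import Data.Nat.Properties as ℕ
open import Data.Product using (_,_; proj₁)
open import Data.Sum as Sum using (inj₁; inj₂)
open import Data.Empty using (⊥-elim)
open import Relation.Binary.Definitions using (tri<; tri≈; tri>)
open import Relation.Binary.PropositionalEquality using (refl; subst; subst₂; sym; trans; cong)
open import Relation.Nullary using (¬_)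

0≤i*i : ∀ i → + 0 ≤ i * i
0≤i*i (+ n)    = subst (+ 0 ≤_) (sym (+◃n≡+n (n ℕ.* n))) (+≤+ z≤n)
0≤i*i -[1+ n ] = +≤+ z≤n

i≤i*i : ∀ i → i ≤ i * i
i≤i*i (+ 0)       = +≤+ z≤n
i≤i*i (+ ℕ.suc n) = +≤+ (ℕ.m≤m*n (ℕ.suc n) (ℕ.suc n))
i≤i*i -[1+ n ]    = -≤+

i<i+j : ∀ {i j} → + 0 < j → i < i + j
i<i+j {i} {j} 0<j = subst (_< i + j) (+-identityʳ i) (+-monoʳ-< i 0<j)

0<i*j : ∀ {i j} → + 0 < i → + 0 < j → + 0 < i * j
0<i*j {i} {j} 0<i 0<j = subst (_< i * j) (*-zeroʳ i) (*-monoˡ-<-pos i {{positive 0<i}} 0<j)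

*-monoˡ-≤-0≤ : ∀ {k i j} → + 0 ≤ k → i ≤ j → k * i ≤ k * j
*-monoˡ-≤-0≤ {k} 0≤k = *-monoˡ-≤-nonNeg k {{nonNegative 0≤k}}

*-monoʳ-≤-0≤ : ∀ {k i j} → + 0 ≤ k → i ≤ j → i * k ≤ j * k
*-monoʳ-≤-0≤ {k} 0≤k = *-monoʳ-≤-nonNeg k {{nonNegative 0≤k}}

*-monoʳ-<-0< : ∀ {k i j} → + 0 < k → i < j → i * k < j * k
*-monoʳ-<-0< {k} 0<k = *-monoʳ-<-pos k {{positive 0<k}}

i≤j⇒i*i≤j*j : ∀ {i j} → + 0 ≤ i → i ≤ j → i * i ≤ j * j
i≤j⇒i*i≤j*j 0≤i i≤j =
  ≤-trans (*-monoˡ-≤-0≤ 0≤i i≤j) (*-monoʳ-≤-0≤ (≤-trans 0≤i i≤j) i≤j)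

≤-by-difference : ∀ {i j k l} → j - i ≡ l - k → k ≤ l → i ≤ j
≤-by-difference eq k≤l = 0≤i-j⇒j≤i (subst (+ 0 ≤_) (sym eq) (i≤j⇒0≤j-i k≤l))

4*i+1≤4*j⇒i<j : ∀ {i j} → + 4 * i + + 1 ≤ + 4 * j → i < j
4*i+1≤4*j⇒i<j h = *-cancelˡ-<-nonNeg (+ 4) (<-≤-trans (i<i+j (+<+ (s≤s z≤n))) h)

4*i≤4*j+1⇒i≤j : ∀ {i j} → + 4 * i ≤ + 4 * j + + 1 → i ≤ j
4*i≤4*j+1⇒i≤j {i} {j} h =
  ≤-by-difference {k = + 1 + i} {l = + 1 + j} (solve (i ∷ j ∷ [])) (i<j⇒suc[i]≤j i<1+j)
  where
  open ≤-Reasoning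
  i<1+j : i < + 1 + j
  i<1+j = *-cancelˡ-<-nonNeg (+ 4) (begin-strict
    + 4 * i            ≤⟨ h ⟩
    + 4 * j + + 1      <⟨ +-monoʳ-< (+ 4 * j) (+<+ (s≤s (s≤s z≤n))) ⟩
    + 4 * j + + 4      ≡⟨ solve (j ∷ []) ⟩
    + 4 * (+ 1 + j)    ∎)

IsFloorSqrt-gap : ∀ {x n} → IsFloorSqrt x n → x - n * n ≤ + 2 * n
IsFloorSqrt-gap {x} {n} (_ , _ , x<[n+1]²) =
  ≤-by-difference {k = + 1 + x} {l = (n + + 1) * (n + + 1)}
    (solve (x ∷ n ∷ [])) (i<j⇒suc[i]≤j x<[n+1]²)

IsFloorSqrt-≮ : ∀ {x m n} → IsFloorSqrt x m → IsFloorSqrt x n → m ≮ n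
IsFloorSqrt-≮ {x} {m} {n} (0≤m , _ , x<[m+1]²) (_ , n²≤x , _) m<n =
  <-irrefl refl (begin-strict
    x                      <⟨ x<[m+1]² ⟩
    (m + + 1) * (m + + 1)  ≤⟨ i≤j⇒i*i≤j*j (+-mono-≤ 0≤m (+≤+ z≤n)) m+1≤n ⟩
    n * n                  ≤⟨ n²≤x ⟩
    x                      ∎)
  where
  open ≤-Reasoning
  m+1≤n : m + + 1 ≤ n
  m+1≤n = subst (_≤ n) (+-comm (+ 1) m) (i<j⇒suc[i]≤j m<n)

IsFloorSqrt-unique : ∀ {x m n} → IsFloorSqrt x m → IsFloorSqrt x n → m ≡ n
IsFloorSqrt-unique m-floor n-floor =
  ≤-antisym (≮⇒≥ (IsFloorSqrt-≮ n-floor m-floor)) (≮⇒≥ (IsFloorSqrt-≮ m-floor n-floor))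

IsNearestSqrt-≮ : ∀ {q r s} → IsNearestSqrt q r → IsNearestSqrt q s → r ≮ s
IsNearestSqrt-≮ {q} {r} {s} (0≤r , _ , 4q<[2r+1]²) (_ , [2s-1]²<4q , _) r<s =
  <-irrefl refl (begin-strict
    + 4 * q                          <⟨ 4q<[2r+1]² ⟩
    (+ 2 * r + + 1) * (+ 2 * r + + 1) ≤⟨ i≤j⇒i*i≤j*j 0≤2r+1 2r+1≤2s-1 ⟩
    (+ 2 * s - + 1) * (+ 2 * s - + 1) <⟨ [2s-1]²<4q ⟩
    + 4 * q                          ∎)
  where
  open ≤-Reasoning
  0≤2r+1 : + 0 ≤ + 2 * r + + 1
  0≤2r+1 = +-mono-≤ (*-monoˡ-≤-0≤ {+ 2} (+≤+ z≤n) 0≤r) (+≤+ z≤n)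
  2r+1≤2s-1 : + 2 * r + + 1 ≤ + 2 * s - + 1
  2r+1≤2s-1 = ≤-by-difference {k = + 2 * (+ 1 + r)} {l = + 2 * s}
    (solve (r ∷ s ∷ [])) (*-monoˡ-≤-0≤ {+ 2} (+≤+ z≤n) (i<j⇒suc[i]≤j r<s))

IsNearestSqrt-unique : ∀ {q r s} → IsNearestSqrt q r → IsNearestSqrt q s → r ≡ s
IsNearestSqrt-unique r-nearest s-nearest =
  ≤-antisym (≮⇒≥ (IsNearestSqrt-≮ s-nearest r-nearest)) (≮⇒≥ (IsNearestSqrt-≮ r-nearest s-nearest))

-a₃≡a*[3q-a²] : ∀ q a → - a₃ q a ≡ a * (+ 3 * q - a * a)
-a₃≡a*[3q-a²] = factor
  where
  -- stated with a₃ unfolded, which the ring solver cannot do itself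
  factor : ∀ q a → - (a * a * a - + 3 * q * a) ≡ a * (+ 3 * q - a * a)
  factor = solve-∀

4q³-a₃²≡[4q-a²][q-a²]² : ∀ q a →
  + 4 * q * q * q - - a₃ q a * - a₃ q a ≡ (+ 4 * q - a * a) * ((q - a * a) * (q - a * a))
4q³-a₃²≡[4q-a²][q-a²]² = factor
  where
  factor : ∀ q a → let a₃ = a * a * a - + 3 * q * a in
    + 4 * q * q * q - - a₃ * - a₃ ≡ (+ 4 * q - a * a) * ((q - a * a) * (q - a * a))
  factor = solve-∀

SqrtDefectBound : ℤ → ℤ → Set
SqrtDefectBound q a = (+ 4 * q - a * a) * ((q - a * a) * (q - a * a)) ≤ + 2 * a * (+ 3 * q - a * a)

IsFloor2SqrtCube⇒SqrtDefectBound : ∀ {q a} → IsFloor2SqrtCube q (- a₃ q a) → SqrtDefectBound q a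
IsFloor2SqrtCube⇒SqrtDefectBound {q} {a} m-floor = begin
  (+ 4 * q - a * a) * ((q - a * a) * (q - a * a)) ≡⟨ sym (4q³-a₃²≡[4q-a²][q-a²]² q a) ⟩
  + 4 * q * q * q - - a₃ q a * - a₃ q a           ≤⟨ IsFloorSqrt-gap m-floor ⟩
  + 2 * - a₃ q a                                  ≡⟨ cong (+ 2 *_) (-a₃≡a*[3q-a²] q a) ⟩
  + 2 * (a * (+ 3 * q - a * a))                   ≡⟨ sym (*-assoc (+ 2) a _) ⟩
  + 2 * a * (+ 3 * q - a * a)                     ∎
  where open ≤-Reasoning

0≤-a₃⇒0≤3q-a² : ∀ {q a} → + 0 < a → + 0 ≤ - a₃ q a → + 0 ≤ + 3 * q - a * a
0≤-a₃⇒0≤3q-a² {q} {a} 0<a 0≤-a₃ = *-cancelˡ-≤-pos (+ 0) (+ 3 * q - a * a) a {{positive 0<a}}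
  (subst₂ _≤_ (sym (*-zeroʳ a)) (-a₃≡a*[3q-a²] q a) 0≤-a₃)

¬SqrtDefectBound-0 : ∀ {q} → + 0 < q → ¬ SqrtDefectBound q (+ 0)
¬SqrtDefectBound-0 {q} 0<q bound = <-irrefl refl (begin-strict
  + 0                                                          <⟨ 0<4q³ ⟩
  + 4 * q * (q * q)                                            ≡⟨ solve (q ∷ []) ⟩
  (+ 4 * q - + 0 * + 0) * ((q - + 0 * + 0) * (q - + 0 * + 0))  ≤⟨ bound ⟩
  + 0                                                          ∎)
  where
  open ≤-Reasoning
  0<4q³ = 0<i*j (0<i*j {+ 4} (+<+ (s≤s z≤n)) 0<q) (0<i*j 0<q 0<q)

SqrtDefectBound⇒IsFloor2Sqrt[-a] : ∀ {q a} → + 0 < q → a < + 0 → AbsLe2Sqrt q a →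
  SqrtDefectBound q a → IsFloor2Sqrt q (- a)
SqrtDefectBound⇒IsFloor2Sqrt[-a] {q} {a} 0<q a<0 a²≤4q bound =
  <⇒≤ 0<-a , [-a]²≤4q , ≰⇒> [-a+1]²≰4q
  where
  open ≤-Reasoning
  0<-a : + 0 < - a
  0<-a = neg-mono-< a<0
  [-a]²≤4q : - a * - a ≤ + 4 * q
  [-a]²≤4q = ≤-by-difference {k = a * a} {l = + 4 * q} (solve (q ∷ a ∷ [])) a²≤4q
  [-a+1]²≰4q : ¬ ((- a + + 1) * (- a + + 1) ≤ + 4 * q)
  [-a+1]²≰4q [-a+1]²≤4q = <-irrefl refl (begin-strict
    + 2 * a * (+ 3 * q - a * a)
      <⟨ i<i+j (0<i*j (0<i*j {+ 4} (+<+ (s≤s z≤n)) 0<-a) 0<q) ⟩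
    + 2 * a * (+ 3 * q - a * a) + + 4 * - a * q
      ≡⟨ solve (q ∷ a ∷ []) ⟩
    + 2 * - a * (a * a - q)
      ≤⟨ *-monoˡ-≤-0≤ (*-monoˡ-≤-0≤ {+ 2} (+≤+ z≤n) (<⇒≤ 0<-a)) (i≤i*i (a * a - q)) ⟩
    + 2 * - a * ((a * a - q) * (a * a - q))
      ≡⟨ solve (q ∷ a ∷ []) ⟩
    + 2 * - a * ((q - a * a) * (q - a * a))
      ≤⟨ *-monoʳ-≤-0≤ (0≤i*i (q - a * a)) (i≤i+j (+ 2 * - a) (+ 1)) ⟩
    (+ 2 * - a + + 1) * ((q - a * a) * (q - a * a))
      ≤⟨ *-monoʳ-≤-0≤ (0≤i*i (q - a * a)) 2[-a]+1≤4q-a² ⟩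
    (+ 4 * q - a * a) * ((q - a * a) * (q - a * a))
      ≤⟨ bound ⟩
    + 2 * a * (+ 3 * q - a * a)
      ∎)
    where
    2[-a]+1≤4q-a² : + 2 * - a + + 1 ≤ + 4 * q - a * a
    2[-a]+1≤4q-a² = ≤-by-difference {k = (- a + + 1) * (- a + + 1)} {l = + 4 * q}
      (solve (q ∷ a ∷ [])) [-a+1]²≤4q

0≤3q-a²⇒0<4q-a² : ∀ {q a} → + 0 < q → + 0 ≤ + 3 * q - a * a → + 0 < + 4 * q - a * a
0≤3q-a²⇒0<4q-a² {q} {a} 0<q 0≤3q-a² = begin-strict
  + 0                  ≤⟨ 0≤3q-a² ⟩
  + 3 * q - a * a      <⟨ i<i+j 0<q ⟩
  + 3 * q - a * a + q  ≡⟨ solve (q ∷ a ∷ []) ⟩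
  + 4 * q - a * a      ∎
  where open ≤-Reasoning

SqrtDefectBound⇒4q<[2a+1]² : ∀ {q a} → + 0 < q → + 0 < a → + 0 ≤ + 3 * q - a * a →
  SqrtDefectBound q a → + 4 * q < (+ 2 * a + + 1) * (+ 2 * a + + 1)
SqrtDefectBound⇒4q<[2a+1]² {q} {a} 0<q 0<a 0≤3q-a² bound = ≰⇒> [2a+1]²≰4q
  where
  open ≤-Reasoning
  0<4q-a² : + 0 < + 4 * q - a * a
  0<4q-a² = 0≤3q-a²⇒0<4q-a² {q} {a} 0<q 0≤3q-a²
  [2a+1]²≰4q : ¬ ((+ 2 * a + + 1) * (+ 2 * a + + 1) ≤ + 4 * q)
  [2a+1]²≰4q [2a+1]²≤4q = <-irrefl refl (begin-strict
    + 2 * a * (+ 3 * q - a * a)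
      ≤⟨ *-monoˡ-≤-0≤ {+ 2 * a} (*-monoˡ-≤-0≤ {+ 2} (+≤+ z≤n) (<⇒≤ 0<a)) 3q-a²≤4q-a² ⟩
    + 2 * a * (+ 4 * q - a * a)
      <⟨ *-monoʳ-<-0< 0<4q-a² (i<i+j {+ 2 * a} {+ 1} (+<+ (s≤s z≤n))) ⟩
    (+ 2 * a + + 1) * (+ 4 * q - a * a)
      ≤⟨ *-monoʳ-≤-0≤ (<⇒≤ 0<4q-a²) 2a+1≤[q-a²]² ⟩
    (q - a * a) * (q - a * a) * (+ 4 * q - a * a)
      ≡⟨ *-comm ((q - a * a) * (q - a * a)) (+ 4 * q - a * a) ⟩
    (+ 4 * q - a * a) * ((q - a * a) * (q - a * a))
      ≤⟨ bound ⟩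
    + 2 * a * (+ 3 * q - a * a)
      ∎)
    where
    3q-a²≤4q-a² : + 3 * q - a * a ≤ + 4 * q - a * a
    3q-a²≤4q-a² = ≤-by-difference {k = + 0} {l = q} (solve (q ∷ a ∷ [])) (<⇒≤ 0<q)
    a²+a<q : a * a + a < q
    a²+a<q = 4*i+1≤4*j⇒i<j (≤-by-difference {k = (+ 2 * a + + 1) * (+ 2 * a + + 1)} {l = + 4 * q}
      (solve (q ∷ a ∷ [])) [2a+1]²≤4q)
    a+1≤q-a² : a + + 1 ≤ q - a * a
    a+1≤q-a² = ≤-by-difference {k = + 1 + (a * a + a)} {l = q}
      (solve (q ∷ a ∷ [])) (i<j⇒suc[i]≤j a²+a<q)
    2a+1≤[q-a²]² : + 2 * a + + 1 ≤ (q - a * a) * (q - a * a)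
    2a+1≤[q-a²]² = ≤-trans
      (≤-by-difference {j = (a + + 1) * (a + + 1)} {k = + 0} {l = a * a} (solve (a ∷ [])) (0≤i*i a))
      (i≤j⇒i*i≤j*j (+-mono-≤ (<⇒≤ 0<a) (+≤+ z≤n)) a+1≤q-a²)

SqrtDefectBound⇒[2a-1]²<4q : ∀ {q a} → + 0 < q → + 0 < a → + 0 ≤ + 3 * q - a * a →
  SqrtDefectBound q a → (+ 2 * a - + 1) * (+ 2 * a - + 1) < + 4 * q
SqrtDefectBound⇒[2a-1]²<4q {q} {a} 0<q 0<a 0≤3q-a² bound = ≰⇒> 4q≰[2a-1]²
  where
  open ≤-Reasoning
  0≤4q-a² : + 0 ≤ + 4 * q - a * a
  0≤4q-a² = <⇒≤ (0≤3q-a²⇒0<4q-a² {q} {a} 0<q 0≤3q-a²)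
  0<2q²+[2q-a²]² : + 0 < + 2 * q * q + (+ 2 * q - a * a) * (+ 2 * q - a * a)
  0<2q²+[2q-a²]² = +-mono-<-≤ (0<i*j (0<i*j {+ 2} (+<+ (s≤s z≤n)) 0<q) 0<q) (0≤i*i (+ 2 * q - a * a))
  4q≰[2a-1]² : ¬ (+ 4 * q ≤ (+ 2 * a - + 1) * (+ 2 * a - + 1))
  4q≰[2a-1]² 4q≤[2a-1]² = <-irrefl refl (begin-strict
    + 2 * a * (+ 3 * q - a * a)
      ≤⟨ *-monoʳ-≤-0≤ 0≤3q-a² (*-monoˡ-≤-0≤ {+ 2} (+≤+ z≤n) a≤a²-q) ⟩
    + 2 * (a * a - q) * (+ 3 * q - a * a)
      <⟨ i<i+j 0<2q²+[2q-a²]² ⟩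
    + 2 * (a * a - q) * (+ 3 * q - a * a) + (+ 2 * q * q + (+ 2 * q - a * a) * (+ 2 * q - a * a))
      ≡⟨ solve (q ∷ a ∷ []) ⟩
    a * a * (+ 4 * q - a * a)
      ≤⟨ *-monoʳ-≤-0≤ 0≤4q-a² (i≤j⇒i*i≤j*j (<⇒≤ 0<a) a≤a²-q) ⟩
    (a * a - q) * (a * a - q) * (+ 4 * q - a * a)
      ≡⟨ solve (q ∷ a ∷ []) ⟩
    (+ 4 * q - a * a) * ((q - a * a) * (q - a * a))
      ≤⟨ bound ⟩
    + 2 * a * (+ 3 * q - a * a)
      ∎)
    where
    q≤a²-a : q ≤ a * a - a
    q≤a²-a = 4*i≤4*j+1⇒i≤j (≤-by-difference {k = + 4 * q} {l = (+ 2 * a - + 1) * (+ 2 * a - + 1)}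
      (solve (q ∷ a ∷ [])) 4q≤[2a-1]²)
    a≤a²-q : a ≤ a * a - q
    a≤a²-q = ≤-by-difference {k = q} {l = a * a - a} (solve (q ∷ a ∷ [])) q≤a²-a

SqrtDefectBound⇒IsNearestSqrt : ∀ {q a} → + 0 < q → + 0 < a → + 0 ≤ + 3 * q - a * a →
  SqrtDefectBound q a → IsNearestSqrt q a
SqrtDefectBound⇒IsNearestSqrt 0<q 0<a 0≤3q-a² bound =
  <⇒≤ 0<a
  , SqrtDefectBound⇒[2a-1]²<4q 0<q 0<a 0≤3q-a² bound
  , SqrtDefectBound⇒4q<[2a+1]² 0<q 0<a 0≤3q-a² bound

proposition14 : (q a₁ : ℤ) → + 3 ≤ q → AbsLe2Sqrt q a₁ →
    (m f r : ℤ) → IsFloor2SqrtCube q m → IsFloor2Sqrt q f → IsNearestSqrt q r →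
    - a₃ q a₁ ≡ m → (a₁ ≡ - f) ⊎ (a₁ ≡ r)
proposition14 q a₁ 3≤q a₁²≤4q _ f r m-floor f-floor r-nearest refl =
  Sum.map a₁≡-f a₁≡r a₁<0⊎0<a₁
  where
  0<q : + 0 < q
  0<q = <-≤-trans (+<+ (s≤s z≤n)) 3≤q
  bound : SqrtDefectBound q a₁
  bound = IsFloor2SqrtCube⇒SqrtDefectBound {q} {a₁} m-floor
  a₁<0⊎0<a₁ : a₁ < + 0 ⊎ + 0 < a₁
  a₁<0⊎0<a₁ with <-cmp a₁ (+ 0)
  ... | tri< a₁<0 _ _ = inj₁ a₁<0
  ... | tri≈ _ a₁≡0 _ = ⊥-elim (¬SqrtDefectBound-0 0<q (subst (SqrtDefectBound q) a₁≡0 bound))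
  ... | tri> _ _ 0<a₁ = inj₂ 0<a₁
  a₁≡-f : a₁ < + 0 → a₁ ≡ - f
  a₁≡-f a₁<0 = trans (sym (neg-involutive a₁)) (cong -_ (IsFloorSqrt-unique
    (SqrtDefectBound⇒IsFloor2Sqrt[-a] 0<q a₁<0 a₁²≤4q bound) f-floor))
  a₁≡r : + 0 < a₁ → a₁ ≡ r
  a₁≡r 0<a₁ = IsNearestSqrt-unique
    (SqrtDefectBound⇒IsNearestSqrt 0<q 0<a₁ (0≤-a₃⇒0≤3q-a² {q} 0<a₁ (proj₁ m-floor)) bound) r-nearest
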